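{- Let $n$ be a positive integer, let $r$ be an integer with $\gcd(r,n)=1$, and let $\varphi\colon\mathbb{Z}_n\to\mathbb{Z}_n$, $x\mapsto rx$, be the corresponding automorphism, of order $m$. Then $\varphi$ is a symmetric skew-morphism of $\mathbb{Z}_n$ if and only if $m\mid n$ and $r\equiv1\pmod{m}$.
   Context: A skew-morphism of a finite group $A$ is a bijection $\varphi\colon A\to A$ fixing the identity with a function $\pi\colon A\to\mathbb{Z}$ (power function) such that $\varphi(xy)=\varphi(x)\varphi^{\pi(x)}(y)$ for all $x,y$; every automorphism is a skew-morphism. A skew-morphism $\varphi$ of $\mathbb{Z}_n$ is symmetric if its order $|\varphi|$ divides $n$ and the function $\pi(x)=-\varphi^{ -x}(-1)$ ($x\in\mathbb{Z}_n$) is a power function of $\varphi$. -}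

module Defs where

open import Data.Nat as ℕ using (ℕ; zero; suc; NonZero; _<_)
open import Data.Nat.DivMod using (_%_; m%n<n)
open import Data.Nat.Divisibility using (_∣_)
open import Data.Fin using (Fin; toℕ; fromℕ<)
open import Data.Integer as ℤ using (ℤ; +_)
open import Data.Integer.DivMod using (_%ℕ_)
open import Data.Product using (Σ; ∃; _×_)
open import Relation.Binary.PropositionalEquality using (_≡_; _≢_)
open import Relation.Nullary using (¬_)

module _ (n : ℕ) .{{_ : NonZero n}} where

  ι : ℕ → Fin n
  ι a = fromℕ< (m%n<n a n)

  zeroZ : Fin n
  zeroZ = ι 0

  addZ : Fin n → Fin n → Fin n
  addZ x y = ι (toℕ x ℕ.+ toℕ y)

  negZ : Fin n → Fin n
  negZ x = ι (n ℕ.∸ toℕ x)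

  minusOne : Fin n
  minusOne = negZ (ι 1)

  mulBy : ℤ → Fin n → Fin n
  mulBy r x = ι ((r ℤ.* (+ toℕ x)) %ℕ n)

iter : {A : Set} → (A → A) → ℕ → A → A
iter f zero    a = a
iter f (suc k) a = f (iter f k a)

powℤ : {A : Set} → (A → A) → (A → A) → ℤ → A → A
powℤ f g (+ k)      = iter f k
powℤ f g ℤ.-[1+ k ] = iter g (suc k)

IsOrder : {A : Set} → (A → A) → ℕ → Set
IsOrder f m =
  (0 < m) × (∀ a → iter f m a ≡ a)
  × (∀ k → 0 < k → k < m → ¬ (∀ a → iter f k a ≡ a))

module _ (n : ℕ) .{{_ : NonZero n}} where

  IsInverse : (Fin n → Fin n) → (Fin n → Fin n) → Set
  IsInverse f g = (∀ x → f (g x) ≡ x) × (∀ x → g (f x) ≡ x)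

  IsPowerFunction : (φ ψ : Fin n → Fin n) → (Fin n → ℤ) → Set
  IsPowerFunction φ ψ π =
    ∀ x y → φ (addZ n x y) ≡ addZ n (φ x) (powℤ φ ψ (π x) y)

  IsSkewMorphism : (Fin n → Fin n) → Set
  IsSkewMorphism φ =
    Σ (Fin n → Fin n) λ ψ → IsInverse φ ψ × (φ (zeroZ n) ≡ zeroZ n)
      × ∃ λ (π : Fin n → ℤ) → IsPowerFunction φ ψ π

  -- Here -φ^{-x}(-1)
  -- is an element of Z_n, read as the integer with representative in [0, n);
  -- since |φ| divides n, the choice of representative does not matter.
  IsSymmetricSkewMorphism : (Fin n → Fin n) → Set
  IsSymmetricSkewMorphism φ =
    Σ (Fin n → Fin n) λ ψ → IsInverse φ ψ × (φ (zeroZ n) ≡ zeroZ n)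
      × (∃ λ m → IsOrder φ m × (m ∣ n))
      × IsPowerFunction φ ψ
          (λ x → + toℕ (negZ n (powℤ φ ψ (ℤ.- (+ toℕ x)) (minusOne n))))

-- Since φ = r · is additive, π is a power function of φ exactly when φ^{π(x)} = φ for
-- all x, i.e. when π(x) ≡ 1 (mod m).  If m ∣ n and r ≡ 1 (mod m) then φ(z) ≡ z (mod m),
-- so every power of φ preserves residues mod m and π(x) = -φ^{-x}(-1) ≡ 1 (mod m).
-- Conversely, at x = 1 we get k := π(1) = -φ^{-1}(-1) ≡ 1 (mod m), while
-- r k ≡ -φ(φ^{-1}(-1)) = 1 (mod n); hence r ≡ r k ≡ 1 (mod m).
module Submission where

open import Defs
open import Data.Nat as ℕ using (ℕ; NonZero; zero; suc; z<s)
open import Data.Integer as ℤ using (ℤ; +_; -[1+_]; 0ℤ; 1ℤ; ∣_∣)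
open import Data.Integer.GCD using (gcd)
open import Data.Integer.Divisibility as ℤD using ()
open import Data.Nat.Divisibility using (_∣_; ∣-antisym; ∣-refl; >⇒∤; m%n≡0⇒n∣m)
open import Data.Product using (_×_; _,_; proj₁; proj₂)
open import Function.Bundles using (_⇔_; mk⇔; Equivalence)
open import Relation.Binary.PropositionalEquality
open import Relation.Binary.Bundles using (Setoid)
open import Relation.Binary.Structures using (IsEquivalence)
import Data.Nat.Properties as ℕP
import Data.Nat.DivMod as ℕD
import Data.Integer.Properties as ℤP
open import Data.Integer.DivMod using (a≡a%ℕn+[a/ℕn]*n)
import Data.Integer.Divisibility.Signed as S
open import Data.Integer.Tactic.RingSolver using (solve-∀)
open import Data.Fin using (Fin; toℕ)
import Data.Fin.Properties as FP
open import Data.Sum using (_⊎_; inj₁; inj₂)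
open import Relation.Nullary using (contradiction)
import Relation.Binary.Reasoning.Setoid as SetoidReasoning

-- A record, not a synonym for the divisibility, so that a, b and k are inferable from a proof.
infix 4 _≡_mod_
record _≡_mod_ (a b : ℤ) (k : ℕ) : Set where
  constructor mk
  field divides-difference : + k S.∣ a ℤ.- b
open _≡_mod_

module _ {k : ℕ} where

  ≡-mod-refl : ∀ {a} → a ≡ a mod k
  ≡-mod-refl {a} = mk (S.divides 0ℤ (ℤP.+-inverseʳ a))

  ≡-mod-sym : ∀ {a b} → a ≡ b mod k → b ≡ a mod k
  ≡-mod-sym {a} {b} (mk k∣a-b) = mk (subst (+ k S.∣_) (negate-difference a b) (S.∣m⇒∣-m k∣a-b))
    where
    negate-difference : ∀ a b → ℤ.- (a ℤ.- b) ≡ b ℤ.- a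
    negate-difference = solve-∀

  ≡-mod-trans : ∀ {a b c} → a ≡ b mod k → b ≡ c mod k → a ≡ c mod k
  ≡-mod-trans {a} {b} {c} (mk k∣a-b) (mk k∣b-c) =
    mk (subst (+ k S.∣_) (telescope a b c) (S.∣m∣n⇒∣m+n k∣a-b k∣b-c))
    where
    telescope : ∀ a b c → (a ℤ.- b) ℤ.+ (b ℤ.- c) ≡ a ℤ.- c
    telescope = solve-∀

  ≡-mod-isEquivalence : IsEquivalence (λ a b → a ≡ b mod k)
  ≡-mod-isEquivalence = record { refl = ≡-mod-refl ; sym = ≡-mod-sym ; trans = ≡-mod-trans }

  +-cong-mod : ∀ {a b c d} → a ≡ b mod k → c ≡ d mod k → a ℤ.+ c ≡ b ℤ.+ d mod k
  +-cong-mod {a} {b} {c} {d} (mk k∣a-b) (mk k∣c-d) =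
    mk (subst (+ k S.∣_) (regroup a b c d) (S.∣m∣n⇒∣m+n k∣a-b k∣c-d))
    where
    regroup : ∀ a b c d → (a ℤ.- b) ℤ.+ (c ℤ.- d) ≡ (a ℤ.+ c) ℤ.- (b ℤ.+ d)
    regroup = solve-∀

  *-cong-mod : ∀ {a b c d} → a ≡ b mod k → c ≡ d mod k → a ℤ.* c ≡ b ℤ.* d mod k
  *-cong-mod {a} {b} {c} {d} (mk k∣a-b) (mk k∣c-d) =
    mk (subst (+ k S.∣_) (regroup a b c d) (S.∣m∣n⇒∣m+n (S.∣m⇒∣m*n c k∣a-b) (S.∣n⇒∣m*n b k∣c-d)))
    where
    regroup : ∀ a b c d → (a ℤ.- b) ℤ.* c ℤ.+ b ℤ.* (c ℤ.- d) ≡ a ℤ.* c ℤ.- b ℤ.* d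
    regroup = solve-∀

  +-congˡ-mod : ∀ a {b c} → b ≡ c mod k → a ℤ.+ b ≡ a ℤ.+ c mod k
  +-congˡ-mod a = +-cong-mod (≡-mod-refl {a})

  +-congʳ-mod : ∀ c {a b} → a ≡ b mod k → a ℤ.+ c ≡ b ℤ.+ c mod k
  +-congʳ-mod c a≡b = +-cong-mod a≡b (≡-mod-refl {c})

  *-congˡ-mod : ∀ a {b c} → b ≡ c mod k → a ℤ.* b ≡ a ℤ.* c mod k
  *-congˡ-mod a = *-cong-mod (≡-mod-refl {a})

  *-congʳ-mod : ∀ c {a b} → a ≡ b mod k → a ℤ.* c ≡ b ℤ.* c mod k
  *-congʳ-mod c a≡b = *-cong-mod a≡b (≡-mod-refl {c})

  -‿cong-mod : ∀ {a b} → a ≡ b mod k → ℤ.- a ≡ ℤ.- b mod k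
  -‿cong-mod {a} {b} (mk k∣a-b) = mk (subst (+ k S.∣_) (regroup a b) (S.∣m⇒∣-m k∣a-b))
    where
    regroup : ∀ a b → ℤ.- (a ℤ.- b) ≡ ℤ.- a ℤ.- ℤ.- b
    regroup = solve-∀

  +-multiple-≡-mod : ∀ a q → a ℤ.+ q ℤ.* + k ≡ a mod k
  +-multiple-≡-mod a q = mk (S.divides q (cancel a q (+ k)))
    where
    cancel : ∀ a q k → a ℤ.+ q ℤ.* k ℤ.- a ≡ q ℤ.* k
    cancel = solve-∀

≡-mod-setoid : ℕ → Setoid _ _
≡-mod-setoid k = record { isEquivalence = ≡-mod-isEquivalence {k} }

module ≡-mod-Reasoning (k : ℕ) = SetoidReasoning (≡-mod-setoid k)

≡-mod-weaken : ∀ {m n a b} → m ∣ n → a ≡ b mod n → a ≡ b mod m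
≡-mod-weaken m∣n (mk n∣a-b) = mk (S.∣-trans (S.∣ᵤ⇒∣ m∣n) n∣a-b)

≡-mod-1 : ∀ a b → a ≡ b mod 1
≡-mod-1 a b = mk (S.divides (a ℤ.- b) (sym (ℤP.*-identityʳ _)))

∣⇒≡0-mod : ∀ {k j} → k ∣ j → + j ≡ 0ℤ mod k
∣⇒≡0-mod {k} {j} k∣j = mk (subst (+ k S.∣_) (sym (ℤP.+-identityʳ (+ j))) (S.∣ᵤ⇒∣ k∣j))

%ℕ-≡-mod : ∀ a n .{{_ : NonZero n}} → + (a ℤ.%ℕ n) ≡ a mod n
%ℕ-≡-mod a n = subst (λ b → + (a ℤ.%ℕ n) ≡ b mod n) (sym (a≡a%ℕn+[a/ℕn]*n a n))
  (≡-mod-sym (+-multiple-≡-mod (+ (a ℤ.%ℕ n)) (a ℤ./ℕ n)))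

≡-mod-<⇒≡ : ∀ {a b n} → + a ≡ + b mod n → a ℕ.< n → b ℕ.< n → a ≡ b
≡-mod-<⇒≡ {a} {b} {n} (mk n∣a-b) a<n b<n =
  ℤP.+-injective (ℤP.i-j≡0⇒i≡j (+ a) (+ b) (ℤP.∣i∣≡0⇒i≡0 (divisor-of-smaller n∣d d<n)))
  where
  d : ℕ
  d = ∣ + a ℤ.- + b ∣
  n∣d : n ∣ d
  n∣d = S.∣⇒∣ᵤ n∣a-b
  d<n : d ℕ.< n
  d<n = ℕP.≤-<-trans (subst (ℕ._≤ a ℕ.⊔ b) (cong ∣_∣ (sym (ℤP.m-n≡m⊖n a b))) (ℤP.∣m⊝n∣≤m⊔n a b))
                     (ℕP.⊔-lub a<n b<n)
  divisor-of-smaller : ∀ {n d} → n ∣ d → d ℕ.< n → d ≡ 0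
  divisor-of-smaller {d = zero} _ _ = refl
  divisor-of-smaller {d = suc _} n∣d d<n = contradiction n∣d (>⇒∤ d<n)

module _ {A : Set} (f : A → A) where

  iter-+ : ∀ j k a → iter f (j ℕ.+ k) a ≡ iter f j (iter f k a)
  iter-+ zero    k a = refl
  iter-+ (suc j) k a = cong f (iter-+ j k a)

  iter-*-period : ∀ {m} → (∀ a → iter f m a ≡ a) → ∀ q a → iter f (q ℕ.* m) a ≡ a
  iter-*-period     period zero    a = refl
  iter-*-period {m} period (suc q) a = begin
    iter f (m ℕ.+ q ℕ.* m) a    ≡⟨ iter-+ m (q ℕ.* m) a ⟩
    iter f m (iter f (q ℕ.* m) a) ≡⟨ cong (iter f m) (iter-*-period period q a) ⟩
    iter f m a                  ≡⟨ period a ⟩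
    a                           ∎
    where open ≡-Reasoning

  iter-% : ∀ {m} .{{_ : NonZero m}} → (∀ a → iter f m a ≡ a) → ∀ k a → iter f k a ≡ iter f (k ℕ.% m) a
  iter-% {m} period k a = begin
    iter f k a                                      ≡⟨ cong (λ j → iter f j a) (ℕD.m≡m%n+[m/n]*n k m) ⟩
    iter f (k ℕ.% m ℕ.+ (k ℕ./ m) ℕ.* m) a          ≡⟨ iter-+ (k ℕ.% m) _ a ⟩
    iter f (k ℕ.% m) (iter f ((k ℕ./ m) ℕ.* m) a)   ≡⟨ cong (iter f (k ℕ.% m)) (iter-*-period period (k ℕ./ m) a) ⟩
    iter f (k ℕ.% m) a                              ∎
    where open ≡-Reasoning

  iter-preserves-mod : ∀ {k} (c : A → ℤ) → (∀ a → c (f a) ≡ c a mod k) → ∀ j a → c (iter f j a) ≡ c a mod k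
  iter-preserves-mod c f-preserves zero    a = ≡-mod-refl
  iter-preserves-mod c f-preserves (suc j) a = ≡-mod-trans (f-preserves _) (iter-preserves-mod c f-preserves j a)

  module _ {m : ℕ} (order : IsOrder f m) where

    private
      instance
        m≢0 : NonZero m
        m≢0 = ℕ.>-nonZero (proj₁ order)
      period : ∀ a → iter f m a ≡ a
      period = proj₁ (proj₂ order)

    order∣period : ∀ {j} → (∀ a → iter f j a ≡ a) → m ∣ j
    order∣period {j} j-period = m%n≡0⇒n∣m j m (remainder-period (j ℕ.% m) refl)
      where
      remainder-period : ∀ r → j ℕ.% m ≡ r → r ≡ 0
      remainder-period zero    _  = refl
      remainder-period (suc r) eq = contradiction
        (λ a → trans (cong (λ i → iter f i a) (sym eq)) (trans (sym (iter-% period j a)) (j-period a)))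
        (proj₂ (proj₂ order) (suc r) z<s (subst (ℕ._< m) eq (ℕD.m%n<n j m)))

    iter-cong-mod : ∀ {j k} → + j ≡ + k mod m → ∀ a → iter f j a ≡ iter f k a
    iter-cong-mod {j} {k} j≡k a = begin
      iter f j a           ≡⟨ iter-% period j a ⟩
      iter f (j ℕ.% m) a   ≡⟨ cong (λ i → iter f i a) remainders-equal ⟩
      iter f (k ℕ.% m) a   ≡⟨ iter-% period k a ⟨
      iter f k a           ∎
      where
      open ≡-Reasoning
      remainders-equal : j ℕ.% m ≡ k ℕ.% m
      remainders-equal = ≡-mod-<⇒≡
        (≡-mod-trans (%ℕ-≡-mod (+ j) m) (≡-mod-trans j≡k (≡-mod-sym (%ℕ-≡-mod (+ k) m))))
        (ℕD.m%n<n j m) (ℕD.m%n<n k m)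

    iter-pred-inverseʳ : ∀ a → f (iter f (ℕ.pred m) a) ≡ a
    iter-pred-inverseʳ a = trans (cong (λ i → iter f i a) (ℕP.suc-pred m)) (period a)

    iter-pred-inverseˡ : ∀ a → iter f (ℕ.pred m) (f a) ≡ a
    iter-pred-inverseˡ a = begin
      iter f (ℕ.pred m) (f a)   ≡⟨ iter-+ (ℕ.pred m) 1 a ⟨
      iter f (ℕ.pred m ℕ.+ 1) a ≡⟨ cong (λ i → iter f i a) (ℕP.+-comm (ℕ.pred m) 1) ⟩
      f (iter f (ℕ.pred m) a)   ≡⟨ iter-pred-inverseʳ a ⟩
      a                         ∎
      where open ≡-Reasoning

    iter≗f⇒≡1-mod : ∀ {g : A → A} → (∀ a → f (g a) ≡ a) → ∀ {k} → (∀ a → iter f k a ≡ f a) → + k ≡ 1ℤ mod m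
    iter≗f⇒≡1-mod f∘g≗id {zero}   f≗id   = ≡-mod-sym (∣⇒≡0-mod (order∣period (λ a → sym (f≗id a))))
    iter≗f⇒≡1-mod {g} f∘g≗id {suc k} fᵏ⁺¹≗f = +-congˡ-mod 1ℤ (∣⇒≡0-mod (order∣period fᵏ≗id))
      where
      fᵏ≗id : ∀ a → iter f k a ≡ a
      fᵏ≗id a = begin
        iter f k a             ≡⟨ cong (iter f k) (f∘g≗id a) ⟨
        iter f k (f (g a))     ≡⟨ iter-+ k 1 (g a) ⟨
        iter f (k ℕ.+ 1) (g a) ≡⟨ cong (λ i → iter f i (g a)) (ℕP.+-comm k 1) ⟩
        iter f (suc k) (g a)   ≡⟨ fᵏ⁺¹≗f (g a) ⟩
        f (g a)                ≡⟨ f∘g≗id a ⟩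
        a                      ∎
        where open ≡-Reasoning

order-unique : ∀ {A : Set} (f : A → A) {m k} → IsOrder f m → IsOrder f k → m ≡ k
order-unique f order-m order-k =
  ∣-antisym (order∣period f order-m (proj₁ (proj₂ order-k))) (order∣period f order-k (proj₁ (proj₂ order-m)))

module _ (n : ℕ) .{{_ : NonZero n}} where

  ⟦_⟧ : Fin n → ℤ
  ⟦ x ⟧ = + toℕ x

  ⟦⟧-injective-mod : ∀ {x y} → ⟦ x ⟧ ≡ ⟦ y ⟧ mod n → x ≡ y
  ⟦⟧-injective-mod x≡y = FP.toℕ-injective (≡-mod-<⇒≡ x≡y (FP.toℕ<n _) (FP.toℕ<n _))

  ⟦ι⟧ : ∀ a → ⟦ ι n a ⟧ ≡ + a mod n
  ⟦ι⟧ a = subst (λ b → + b ≡ + a mod n) (sym (FP.toℕ-fromℕ< (ℕD.m%n<n a n))) (%ℕ-≡-mod (+ a) n)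

  ⟦zeroZ⟧ : ⟦ zeroZ n ⟧ ≡ 0ℤ mod n
  ⟦zeroZ⟧ = ⟦ι⟧ 0

  ⟦addZ⟧ : ∀ x y → ⟦ addZ n x y ⟧ ≡ ⟦ x ⟧ ℤ.+ ⟦ y ⟧ mod n
  ⟦addZ⟧ x y = ⟦ι⟧ (toℕ x ℕ.+ toℕ y)

  ⟦negZ⟧ : ∀ x → ⟦ negZ n x ⟧ ≡ ℤ.- ⟦ x ⟧ mod n
  ⟦negZ⟧ x = begin
    ⟦ negZ n x ⟧           ≈⟨ ⟦ι⟧ (n ℕ.∸ toℕ x) ⟩
    + (n ℕ.∸ toℕ x)        ≡⟨ ℤP.⊖-≥ (ℕP.<⇒≤ (FP.toℕ<n x)) ⟨
    n ℤ.⊖ toℕ x            ≡⟨ ℤP.m-n≡m⊖n n (toℕ x) ⟨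
    + n ℤ.- ⟦ x ⟧          ≈⟨ +-congʳ-mod (ℤ.- ⟦ x ⟧) (∣⇒≡0-mod (∣-refl {n})) ⟩
    0ℤ ℤ.- ⟦ x ⟧           ≡⟨ ℤP.+-identityˡ _ ⟩
    ℤ.- ⟦ x ⟧              ∎
    where open ≡-mod-Reasoning n

  ⟦minusOne⟧ : ⟦ minusOne n ⟧ ≡ ℤ.- 1ℤ mod n
  ⟦minusOne⟧ = ≡-mod-trans (⟦negZ⟧ (ι n 1)) (-‿cong-mod (⟦ι⟧ 1))

  ⟦mulBy⟧ : ∀ r x → ⟦ mulBy n r x ⟧ ≡ r ℤ.* ⟦ x ⟧ mod n
  ⟦mulBy⟧ r x = ≡-mod-trans (⟦ι⟧ _) (%ℕ-≡-mod (r ℤ.* ⟦ x ⟧) n)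

  addZ-cancelˡ : ∀ a {b c} → addZ n a b ≡ addZ n a c → b ≡ c
  addZ-cancelˡ a {b} {c} a+b≡a+c = ⟦⟧-injective-mod (begin
    ⟦ b ⟧                              ≡⟨ cancel ⟦ a ⟧ ⟦ b ⟧ ⟩
    ℤ.- ⟦ a ⟧ ℤ.+ (⟦ a ⟧ ℤ.+ ⟦ b ⟧)    ≈⟨ +-congˡ-mod (ℤ.- ⟦ a ⟧) (⟦addZ⟧ a b) ⟨
    ℤ.- ⟦ a ⟧ ℤ.+ ⟦ addZ n a b ⟧       ≡⟨ cong (λ z → ℤ.- ⟦ a ⟧ ℤ.+ ⟦ z ⟧) a+b≡a+c ⟩
    ℤ.- ⟦ a ⟧ ℤ.+ ⟦ addZ n a c ⟧       ≈⟨ +-congˡ-mod (ℤ.- ⟦ a ⟧) (⟦addZ⟧ a c) ⟩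
    ℤ.- ⟦ a ⟧ ℤ.+ (⟦ a ⟧ ℤ.+ ⟦ c ⟧)    ≡⟨ cancel ⟦ a ⟧ ⟦ c ⟧ ⟨
    ⟦ c ⟧                              ∎)
    where
    open ≡-mod-Reasoning n
    cancel : ∀ a b → b ≡ ℤ.- a ℤ.+ (a ℤ.+ b)
    cancel = solve-∀

  module _ (r : ℤ) where

    mulBy-+ : ∀ x y → mulBy n r (addZ n x y) ≡ addZ n (mulBy n r x) (mulBy n r y)
    mulBy-+ x y = ⟦⟧-injective-mod (begin
      ⟦ mulBy n r (addZ n x y) ⟧                  ≈⟨ ⟦mulBy⟧ r _ ⟩
      r ℤ.* ⟦ addZ n x y ⟧                        ≈⟨ *-congˡ-mod r (⟦addZ⟧ x y) ⟩
      r ℤ.* (⟦ x ⟧ ℤ.+ ⟦ y ⟧)                     ≡⟨ ℤP.*-distribˡ-+ r ⟦ x ⟧ ⟦ y ⟧ ⟩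
      r ℤ.* ⟦ x ⟧ ℤ.+ r ℤ.* ⟦ y ⟧                 ≈⟨ +-cong-mod (⟦mulBy⟧ r x) (⟦mulBy⟧ r y) ⟨
      ⟦ mulBy n r x ⟧ ℤ.+ ⟦ mulBy n r y ⟧         ≈⟨ ⟦addZ⟧ (mulBy n r x) (mulBy n r y) ⟨
      ⟦ addZ n (mulBy n r x) (mulBy n r y) ⟧      ∎)
      where open ≡-mod-Reasoning n

    mulBy-zeroZ : mulBy n r (zeroZ n) ≡ zeroZ n
    mulBy-zeroZ = ⟦⟧-injective-mod (begin
      ⟦ mulBy n r (zeroZ n) ⟧   ≈⟨ ⟦mulBy⟧ r _ ⟩
      r ℤ.* ⟦ zeroZ n ⟧         ≈⟨ *-congˡ-mod r ⟦zeroZ⟧ ⟩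
      r ℤ.* 0ℤ                  ≡⟨ ℤP.*-zeroʳ r ⟩
      0ℤ                        ≈⟨ ⟦zeroZ⟧ ⟨
      ⟦ zeroZ n ⟧               ∎)
      where open ≡-mod-Reasoning n

    mulBy-inverts-negZ-preimage : ∀ {w} → mulBy n r w ≡ minusOne n → r ℤ.* ⟦ negZ n w ⟧ ≡ 1ℤ mod n
    mulBy-inverts-negZ-preimage {w} rw≡-1 = begin
      r ℤ.* ⟦ negZ n w ⟧        ≈⟨ *-congˡ-mod r (⟦negZ⟧ w) ⟩
      r ℤ.* ℤ.- ⟦ w ⟧           ≡⟨ ℤP.neg-distribʳ-* r ⟦ w ⟧ ⟨
      ℤ.- (r ℤ.* ⟦ w ⟧)         ≈⟨ -‿cong-mod (⟦mulBy⟧ r w) ⟨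
      ℤ.- ⟦ mulBy n r w ⟧       ≡⟨ cong (λ z → ℤ.- ⟦ z ⟧) rw≡-1 ⟩
      ℤ.- ⟦ minusOne n ⟧        ≈⟨ -‿cong-mod ⟦minusOne⟧ ⟩
      ℤ.- (ℤ.- 1ℤ)              ≡⟨ ℤP.neg-involutive 1ℤ ⟩
      1ℤ                        ∎
      where open ≡-mod-Reasoning n

  symmetric-power : (φ ψ : Fin n → Fin n) → Fin n → ℤ
  symmetric-power φ ψ x = + toℕ (negZ n (powℤ φ ψ (ℤ.- ⟦ x ⟧) (minusOne n)))

  module _ {φ : Fin n → Fin n} (φ-+ : ∀ x y → φ (addZ n x y) ≡ addZ n (φ x) (φ y))
           (ψ : Fin n → Fin n) (π : Fin n → ℤ) where

    additive-power-function⇔ : IsPowerFunction n φ ψ π ⇔ (∀ x y → powℤ φ ψ (π x) y ≡ φ y)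
    additive-power-function⇔ = mk⇔
      (λ power x y → addZ-cancelˡ (φ x) (sym (trans (sym (φ-+ x y)) (power x y))))
      (λ φ^π≗φ x y → trans (φ-+ x y) (cong (addZ n (φ x)) (sym (φ^π≗φ x y))))

n≡1⊎toℕ[ι1]≡1 : ∀ n .{{_ : NonZero n}} → n ≡ 1 ⊎ toℕ (ι n 1) ≡ 1
n≡1⊎toℕ[ι1]≡1 (suc zero)    = inj₁ refl
n≡1⊎toℕ[ι1]≡1 (suc (suc _)) = inj₂ refl

module _ (n : ℕ) .{{_ : NonZero n}} (r : ℤ) {m : ℕ} (order : IsOrder (mulBy n r) m) where

  private
    φ : Fin n → Fin n
    φ = mulBy n r

  mulBy-symmetric : m ∣ n → r ≡ 1ℤ mod m → IsSymmetricSkewMorphism n φ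
  mulBy-symmetric m∣n r≡1 =
    ψ , (iter-pred-inverseʳ φ order , iter-pred-inverseˡ φ order) , mulBy-zeroZ n r , (m , order , m∣n)
      , Equivalence.from (additive-power-function⇔ n (mulBy-+ n r) ψ (symmetric-power n φ ψ))
          (λ x → iter-cong-mod φ order (symmetric-power≡1 x))
    where
    ψ : Fin n → Fin n
    ψ = iter φ (ℕ.pred m)
    φ-fixes-class : ∀ z → ⟦ n ⟧ (φ z) ≡ ⟦ n ⟧ z mod m
    φ-fixes-class z = begin
      ⟦ n ⟧ (φ z)      ≈⟨ ≡-mod-weaken m∣n (⟦mulBy⟧ n r z) ⟩
      r ℤ.* ⟦ n ⟧ z    ≈⟨ *-congʳ-mod (⟦ n ⟧ z) r≡1 ⟩
      1ℤ ℤ.* ⟦ n ⟧ z   ≡⟨ ℤP.*-identityˡ _ ⟩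
      ⟦ n ⟧ z          ∎
      where open ≡-mod-Reasoning m
    powers-fix-class : ∀ i z → ⟦ n ⟧ (powℤ φ ψ i z) ≡ ⟦ n ⟧ z mod m
    powers-fix-class (+ j)     = iter-preserves-mod φ (⟦ n ⟧) φ-fixes-class j
    powers-fix-class -[1+ j ] =
      iter-preserves-mod ψ (⟦ n ⟧) (iter-preserves-mod φ (⟦ n ⟧) φ-fixes-class (ℕ.pred m)) (suc j)
    symmetric-power≡1 : ∀ x → symmetric-power n φ ψ x ≡ 1ℤ mod m
    symmetric-power≡1 x = begin
      symmetric-power n φ ψ x                   ≈⟨ ≡-mod-weaken m∣n (⟦negZ⟧ n (powℤ φ ψ i (minusOne n))) ⟩
      ℤ.- ⟦ n ⟧ (powℤ φ ψ i (minusOne n))       ≈⟨ -‿cong-mod (powers-fix-class i (minusOne n)) ⟩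
      ℤ.- ⟦ n ⟧ (minusOne n)                    ≈⟨ -‿cong-mod (≡-mod-weaken m∣n (⟦minusOne⟧ n)) ⟩
      ℤ.- (ℤ.- 1ℤ)                              ≡⟨ ℤP.neg-involutive 1ℤ ⟩
      1ℤ                                        ∎
      where
      open ≡-mod-Reasoning m
      i : ℤ
      i = ℤ.- ⟦ n ⟧ x

  symmetric⇒≡1 : IsSymmetricSkewMorphism n φ → m ∣ n × r ≡ 1ℤ mod m
  symmetric⇒≡1 (ψ , (φ∘ψ≗id , _) , _ , (m′ , order′ , m′∣n) , power) = m∣n , r≡1
    where
    m∣n : m ∣ n
    m∣n = subst (_∣ n) (order-unique φ order′ order) m′∣n
    r≡1 : r ≡ 1ℤ mod m
    -- In Z_1 the residue ι 1 is 0, and the power-function equation at x = ι 1 says nothing.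
    r≡1 with n≡1⊎toℕ[ι1]≡1 n
    ... | inj₁ n≡1 = ≡-mod-weaken (subst (m ∣_) n≡1 m∣n) (≡-mod-1 r 1ℤ)
    ... | inj₂ ι1≡1 = begin
      r              ≡⟨ ℤP.*-identityʳ r ⟨
      r ℤ.* 1ℤ       ≈⟨ *-congˡ-mod r k≡1 ⟨
      r ℤ.* + k      ≈⟨ ≡-mod-weaken m∣n (mulBy-inverts-negZ-preimage n r (φ∘ψ≗id (minusOne n))) ⟩
      1ℤ             ∎
      where
      open ≡-mod-Reasoning m
      w : Fin n
      w = ψ (minusOne n)
      k : ℕ
      k = toℕ (negZ n w)
      π[ι1]≡k : symmetric-power n φ ψ (ι n 1) ≡ + k
      π[ι1]≡k = cong (λ t → + toℕ (negZ n (powℤ φ ψ (ℤ.- + t) (minusOne n)))) ι1≡1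
      φᵏ≗φ : ∀ y → iter φ k y ≡ φ y
      φᵏ≗φ y = subst (λ i → powℤ φ ψ i y ≡ φ y) π[ι1]≡k
        (Equivalence.to (additive-power-function⇔ n (mulBy-+ n r) ψ (symmetric-power n φ ψ)) power (ι n 1) y)
      k≡1 : + k ≡ 1ℤ mod m
      k≡1 = iter≗f⇒≡1-mod φ order φ∘ψ≗id φᵏ≗φ

theorem5 : (n : ℕ) .{{_ : NonZero n}} (r : ℤ) → gcd r (+ n) ≡ + 1
    → (m : ℕ) → IsOrder (mulBy n r) m
    → IsSymmetricSkewMorphism n (mulBy n r) ⇔ ((m ∣ n) × ((+ m) ℤD.∣ (r ℤ.- + 1)))
theorem5 n r _ m order = mk⇔
  (λ symmetric → let m∣n , r≡1 = symmetric⇒≡1 n r order symmetric in m∣n , S.∣⇒∣ᵤ (divides-difference r≡1))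
  (λ (m∣n , m∣r-1) → mulBy-symmetric n r order m∣n (mk (S.∣ᵤ⇒∣ m∣r-1)))
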